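{- Let $G=C_n^r$ and suppose $\eta(G)=c(n-1)+1$ for some positive integer $c$. If $c\leq n$ and $G$ has Property C, then $\eta(G)-1\in C_0(G)$.
   Context: $C_n^r$ is the direct sum of $r$ copies of the cyclic group $C_n$. A sequence over $G$ is a finite unordered list of elements of $G$ with repetition allowed; length counts multiplicity; $g^{k}$ denotes $k$ copies of $g$. A short zero-sum sequence is a sequence with sum $0$ and length in $[1,\exp(G)]$; a sequence is short free if it contains no short zero-sum subsequence. $D(G)$ is the smallest $d$ such that every sequence over $G$ of length $\ge d$ has a nonempty zero-sum subsequence; $\eta(G)$ is the smallest $d$ such that every sequence of length $\ge d$ has a short zero-sum subsequence. $C_0(G)$ is the set of integers $t\in[D(G)+1,\eta(G)-1]$ such that every zero-sum sequence over $G$ of length exactly $t$ contains a short zero-sum subsequence. Property C: $C_n^r$ has Property C if $\eta(C_n^r)=c(n-1)+1$ for some positive integer $c$ and every short free sequence over $C_n^r$ of length $c(n-1)$ has the form $\prod_{i=1}^c g_i^{n-1}$ with $g_1,\dots,g_c$ pairwise distinct elements of $C_n^r$. -}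

module Defs where

open import Data.Nat using (ℕ; zero; suc; _+_; _*_; _∸_; _≤_)
open import Data.Nat.Divisibility using (_∣_)
open import Data.Fin using (Fin; toℕ)
open import Data.Vec using (Vec; lookup)
open import Data.List using (List; length; map; concat; replicate)
open import Data.Nat.ListAction using (sum)
open import Data.List.Relation.Binary.Sublist.Propositional using (_⊆_)
open import Data.List.Relation.Binary.Permutation.Propositional using (_↭_)
open import Data.Product using (Σ; ∃; _×_)
open import Relation.Nullary using (¬_)
open import Relation.Binary.PropositionalEquality using (_≡_; _≢_)

-- The group C_n^r: vectors of length r over Fin n (componentwise addition mod n).
Grp : ℕ → ℕ → Set
Grp n r = Vec (Fin n) r

-- A sequence over G (unordered; represented by a list, order irrelevant).
Seq : ℕ → ℕ → Set
Seq n r = List (Grp n r)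

-- The sum of a sequence is 0 in C_n^r iff every coordinate sum is divisible by n.
ZeroSum : ∀ {n r} → Seq n r → Set
ZeroSum {n} {r} xs = ∀ (i : Fin r) → n ∣ sum (map (λ g → toℕ (lookup g i)) xs)

-- Subsequences (sub-multisets) of a list are given by sublists.
-- Nonempty zero-sum subsequence.
HasZS : ∀ {n r} → Seq n r → Set
HasZS {n} {r} xs = Σ (Seq n r) λ ys → ys ⊆ xs × 1 ≤ length ys × ZeroSum ys

-- Short zero-sum subsequence: length in [1, exp(G)] where exp(C_n^r) = n.
HasShortZS : ∀ {n r} → Seq n r → Set
HasShortZS {n} {r} xs =
  Σ (Seq n r) λ ys → ys ⊆ xs × 1 ≤ length ys × length ys ≤ n × ZeroSum ys

ShortFree : ∀ {n r} → Seq n r → Set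
ShortFree xs = ¬ HasShortZS xs

IsDavenport : ℕ → ℕ → ℕ → Set
IsDavenport n r d =
  (∀ (xs : Seq n r) → d ≤ length xs → HasZS xs) ×
  (∀ d′ → (∀ (xs : Seq n r) → d′ ≤ length xs → HasZS xs) → d ≤ d′)

IsEta : ℕ → ℕ → ℕ → Set
IsEta n r d =
  (∀ (xs : Seq n r) → d ≤ length xs → HasShortZS xs) ×
  (∀ d′ → (∀ (xs : Seq n r) → d′ ≤ length xs → HasShortZS xs) → d ≤ d′)

InC0 : (n r D η t : ℕ) → Set
InC0 n r D η t =
  D + 1 ≤ t × t ≤ η ∸ 1 ×
  (∀ (xs : Seq n r) → length xs ≡ t → ZeroSum xs → HasShortZS xs)

PropertyC : ℕ → ℕ → Set
PropertyC n r =
  Σ ℕ λ c → 1 ≤ c × IsEta n r (c * (n ∸ 1) + 1) ×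
    (∀ (xs : Seq n r) → length xs ≡ c * (n ∸ 1) → ShortFree xs →
      Σ (Vec (Grp n r) c) λ gs →
        (∀ (i j : Fin c) → i ≢ j → lookup gs i ≢ lookup gs j) ×
        (xs ↭ concat (Data.List.map (λ g → replicate (n ∸ 1) g)
                                    (Data.Vec.toList gs))))

-- Write n for the exponent, σ for the sum of a sequence and t = c(n − 1) = η − 1.
-- If a zero-sum sequence of length t were short free, Property C would make it a
-- rearrangement of g₁^(n−1) ⋯ g_c^(n−1);
-- then 0 = (n − 1)(g₁ + ⋯ + g_c) forces g₁ + ⋯ + g_c = 0, a zero-sum subsequence of
-- length c ≤ n.  Hence t ∈ C₀ once D < t.
-- For that, extend a sequence T of length t − 1 ≥ n by −σ(T): the result is zero-sum of
-- length t, and a short zero-sum subsequence of it yields a nonempty zero-sum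
-- subsequence of T, either directly or as the complement in T of the part that
-- accompanies −σ(T) (nonempty because that part has fewer than n terms).  The bound
-- t − 1 ≥ n holds because η ≥ 3n − 2 for r ≥ 2, witnessed by e₁^(n−1) e₂^(n−1) (e₁+e₂)^(n−1).

module Submission where

open import Defs
open import Data.Nat using (ℕ; zero; suc; _+_; _*_; _∸_; _≤_; _<_; z≤n; s≤s; _≤?_)
open import Data.Nat.Properties
open import Data.Nat.Tactic.RingSolver using (solve-∀)
open import Data.Nat.Divisibility using (_∣_; _∣?_; ∣m+n∣m⇒∣n; ∣⇒≤; m∣m*n; n∣m*n; >⇒∤)
open import Data.Nat.DivMod using (_%_; _/_; m≡m%n+[m/n]*n; m%n<n)
open import Data.Nat.ListAction using (sum)
open import Data.Nat.ListAction.Properties using (sum-↭; sum-++)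
open import Data.Fin using (Fin; toℕ; fromℕ<) renaming (zero to 0F; suc to fsuc)
import Data.Fin.Properties as Fin
open import Data.Vec as Vec using (_∷_; lookup; tabulate; toList)
import Data.Vec.Properties as Vec
open import Data.List using (List; []; _∷_; length; map; concat; replicate; _++_; take)
open import Data.List.Properties using (map-++; length-replicate; length-++; length-take)
open import Data.List.Relation.Unary.Any as Any using (Any; here; any?)
import Data.List.Relation.Unary.Any.Properties as Any
open import Data.List.Relation.Binary.Sublist.Propositional using (_⊆_; []; _∷_; _∷ʳ_; ⊆-trans)
open import Data.List.Relation.Binary.Sublist.Propositional.Properties using (length-mono-≤; take-⊆)
open import Data.List.Relation.Binary.Permutation.Propositional
  using (_↭_; refl; prep; swap; trans; ↭-sym)
import Data.List.Relation.Binary.Permutation.Propositional.Properties as ↭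
open import Data.Product using (Σ; _×_; _,_; proj₁; map₂)
open import Function using (_∘_)
open import Relation.Nullary using (¬_; Dec; yes; no; contradiction)
open import Relation.Nullary.Decidable using (_×-dec_; decidable-stable)
open import Relation.Unary using (Pred; Decidable)
open import Relation.Binary.PropositionalEquality
  using (_≡_; cong; cong₂; sym; subst; subst₂; module ≡-Reasoning)
  renaming (refl to ≡-refl; trans to ≡-trans)

module _ {A : Set} where

  sublists : (xs : List A) → List (Σ (List A) (_⊆ xs))
  sublists []       = ([] , []) ∷ []
  sublists (x ∷ xs) = map (map₂ (x ∷ʳ_)) (sublists xs)
                   ++ map (λ (ys , p) → x ∷ ys , ≡-refl ∷ p) (sublists xs)

  sublists-complete : ∀ {ys xs} → ys ⊆ xs → Any ((ys ≡_) ∘ proj₁) (sublists xs)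
  sublists-complete []                  = here ≡-refl
  sublists-complete (x ∷ʳ p)            = Any.++⁺ˡ (Any.map⁺ (sublists-complete p))
  sublists-complete {xs = x ∷ xs} (≡-refl ∷ p) =
    Any.++⁺ʳ (map _ (sublists xs)) (Any.map⁺ (Any.map (cong (x ∷_)) (sublists-complete p)))

  any-sublist? : ∀ {ℓ} {P : Pred (List A) ℓ} → Decidable P →
                 ∀ xs → Dec (Σ (List A) λ ys → ys ⊆ xs × P ys)
  any-sublist? P? xs with any? (P? ∘ proj₁) (sublists xs)
  ... | yes found = let ((ys , p) , pys) = Any.satisfied found in yes (ys , p , pys)
  ... | no none   = no λ (ys , p , pys) →
    none (Any.map (λ { ≡-refl → pys }) (sublists-complete p))

  ⊆-↭ : ∀ {ys xs xs′} → ys ⊆ xs → xs ↭ xs′ → Σ (List A) λ ys′ → ys′ ⊆ xs′ × ys ↭ ys′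
  ⊆-↭ p refl = _ , p , refl
  ⊆-↭ (x ∷ʳ p) (prep _ e) with ⊆-↭ p e
  ... | ys′ , q , f = ys′ , x ∷ʳ q , f
  ⊆-↭ (≡-refl ∷ p) (prep x e) with ⊆-↭ p e
  ... | ys′ , q , f = x ∷ ys′ , ≡-refl ∷ q , prep x f
  ⊆-↭ (_ ∷ʳ (_ ∷ʳ p)) (swap x y e) with ⊆-↭ p e
  ... | ys′ , q , f = ys′ , y ∷ʳ (x ∷ʳ q) , f
  ⊆-↭ (_ ∷ʳ (≡-refl ∷ p)) (swap x y e) with ⊆-↭ p e
  ... | ys′ , q , f = y ∷ ys′ , ≡-refl ∷ (x ∷ʳ q) , prep y f
  ⊆-↭ (≡-refl ∷ (_ ∷ʳ p)) (swap x y e) with ⊆-↭ p e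
  ... | ys′ , q , f = x ∷ ys′ , y ∷ʳ (≡-refl ∷ q) , prep x f
  ⊆-↭ (≡-refl ∷ (≡-refl ∷ p)) (swap x y e) with ⊆-↭ p e
  ... | ys′ , q , f = y ∷ x ∷ ys′ , ≡-refl ∷ (≡-refl ∷ q) , swap x y f
  ⊆-↭ p (trans e₁ e₂) with ⊆-↭ p e₁
  ... | ys₁ , q₁ , f₁ with ⊆-↭ q₁ e₂
  ... | ys₂ , q₂ , f₂ = ys₂ , q₂ , trans f₁ f₂

  complement : ∀ {ys xs} → ys ⊆ xs → List A
  complement []       = []
  complement (x ∷ʳ p) = x ∷ complement p
  complement (_ ∷ p)  = complement p

  complement-⊆ : ∀ {ys xs} (p : ys ⊆ xs) → complement p ⊆ xs
  complement-⊆ []       = []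
  complement-⊆ (x ∷ʳ p) = ≡-refl ∷ complement-⊆ p
  complement-⊆ (_∷_ {y = x} _ p) = x ∷ʳ complement-⊆ p

  ++-complement-↭ : ∀ {ys xs} (p : ys ⊆ xs) → ys ++ complement p ↭ xs
  ++-complement-↭ []               = refl
  ++-complement-↭ {ys} (x ∷ʳ p)    =
    trans (↭.shift x ys (complement p)) (prep x (++-complement-↭ p))
  ++-complement-↭ (≡-refl ∷ p)     = prep _ (++-complement-↭ p)

  ⊆-++⁻ : ∀ {ys} xs {zs} → ys ⊆ xs ++ zs →
          Σ (List A) λ ys₁ → Σ (List A) λ ys₂ → ys₁ ⊆ xs × ys₂ ⊆ zs × ys ≡ ys₁ ++ ys₂
  ⊆-++⁻ []       p        = [] , _ , [] , p , ≡-refl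
  ⊆-++⁻ (x ∷ xs) (_ ∷ʳ p) with ⊆-++⁻ xs p
  ... | ys₁ , ys₂ , p₁ , p₂ , ≡-refl = ys₁ , ys₂ , x ∷ʳ p₁ , p₂ , ≡-refl
  ⊆-++⁻ (x ∷ xs) (≡-refl ∷ p) with ⊆-++⁻ xs p
  ... | ys₁ , ys₂ , p₁ , p₂ , ≡-refl = x ∷ ys₁ , ys₂ , ≡-refl ∷ p₁ , p₂ , ≡-refl

  ⊆-replicate : ∀ {ys} k {x : A} → ys ⊆ replicate k x → ys ≡ replicate (length ys) x
  ⊆-replicate zero    []           = ≡-refl
  ⊆-replicate (suc k) (_ ∷ʳ p)     = ⊆-replicate k p
  ⊆-replicate (suc k) (≡-refl ∷ p) = cong (_ ∷_) (⊆-replicate k p)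

  replicateEach : ℕ → List A → List A
  replicateEach k xs = concat (map (replicate k) xs)

  ⊆-replicateEach : ∀ k xs → xs ⊆ replicateEach (suc k) xs
  ⊆-replicateEach k []       = []
  ⊆-replicateEach k (x ∷ xs) = ≡-refl ∷ skip k
    where
      skip : ∀ j → xs ⊆ replicate j x ++ replicateEach (suc k) xs
      skip zero    = ⊆-replicateEach k xs
      skip (suc j) = x ∷ʳ skip j

  sum-map-replicate : ∀ (f : A → ℕ) k x → sum (map f (replicate k x)) ≡ k * f x
  sum-map-replicate f zero    x = ≡-refl
  sum-map-replicate f (suc k) x = cong (f x +_) (sum-map-replicate f k x)

  sum-map-⊆-replicate : ∀ (f : A → ℕ) k {x : A} {ys} → ys ⊆ replicate k x →
                        sum (map f ys) ≡ length ys * f x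
  sum-map-⊆-replicate f k {x} {ys} ys⊆ =
    ≡-trans (cong (sum ∘ map f) (⊆-replicate k ys⊆)) (sum-map-replicate f (length ys) x)

  sum-map-++ : ∀ (f : A → ℕ) xs ys → sum (map f (xs ++ ys)) ≡ sum (map f xs) + sum (map f ys)
  sum-map-++ f xs ys = ≡-trans (cong sum (map-++ f xs ys)) (sum-++ (map f xs) (map f ys))

  sum-map-replicateEach : ∀ (f : A → ℕ) k xs →
                          sum (map f (replicateEach k xs)) ≡ k * sum (map f xs)
  sum-map-replicateEach f k []       = sym (*-zeroʳ k)
  sum-map-replicateEach f k (x ∷ xs) = begin
    sum (map f (replicate k x ++ replicateEach k xs))        ≡⟨ sum-map-++ f (replicate k x) _ ⟩
    sum (map f (replicate k x)) + sum (map f (replicateEach k xs))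
      ≡⟨ cong₂ _+_ (sum-map-replicate f k x) (sum-map-replicateEach f k xs) ⟩
    k * f x + k * sum (map f xs)                             ≡⟨ *-distribˡ-+ k (f x) _ ⟨
    k * (f x + sum (map f xs))                               ∎
    where open ≡-Reasoning

∣∧<⇒≡0 : ∀ {n a} → n ∣ a → a < n → a ≡ 0
∣∧<⇒≡0 {a = zero}  _   _   = ≡-refl
∣∧<⇒≡0 {a = suc _} n∣a a<n = contradiction n∣a (>⇒∤ a<n)

∣∧0<⇒≤ : ∀ {n m} → n ∣ m → 0 < m → n ≤ m
∣∧0<⇒≤ {m = suc _} n∣m _ = ∣⇒≤ n∣m

-- a, b, t count the terms e₁, e₂, e₁ + e₂ in a subsequence of e₁^(n−1) e₂^(n−1) (e₁+e₂)^(n−1).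
∣a+t∧∣b+t⇒n<a+b+t : ∀ {n a b t} → a < n → b < n → t < n → n ∣ a + t → n ∣ b + t →
                     0 < a + (b + t) → n < a + (b + t)
∣a+t∧∣b+t⇒n<a+b+t {n} {a} {b} {zero} a<n b<n _ n∣a n∣b 0<
  with ∣∧<⇒≡0 (subst (n ∣_) (+-identityʳ a) n∣a) a<n
     | ∣∧<⇒≡0 (subst (n ∣_) (+-identityʳ b) n∣b) b<n
... | ≡-refl | ≡-refl = contradiction 0< λ ()
∣a+t∧∣b+t⇒n<a+b+t {b = zero} {t = suc _} _ _ t<n _ n∣t _ =
  contradiction (∣∧0<⇒≤ n∣t (s≤s z≤n)) (<⇒≱ t<n)
∣a+t∧∣b+t⇒n<a+b+t {n} {a} {b@(suc _)} {t@(suc _)} _ _ _ n∣a+t _ _ =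
  subst₂ _≤_ (+-comm n 1) (≡-trans (+-assoc a t b) (cong (a +_) (+-comm t b)))
         (+-mono-≤ (∣∧0<⇒≤ n∣a+t (≤-trans (s≤s z≤n) (m≤n+m t a))) (s≤s z≤n))

n<3[n∸1] : ∀ m → suc (suc m) < 3 * suc m
n<3[n∸1] m = subst (3 + m ≤_) (rearrange m) (m≤m+n (3 + m) (m + m))
  where
    rearrange : ∀ m → 3 + m + (m + m) ≡ 3 * suc m
    rearrange = solve-∀

coord : ∀ {n r} → Fin r → Grp n r → ℕ
coord i g = toℕ (lookup g i)

zeroSum? : ∀ {n r} (xs : Seq n r) → Dec (ZeroSum xs)
zeroSum? {n} xs = Fin.all? λ i → n ∣? sum (map (coord i) xs)

hasShortZS? : ∀ {n r} (xs : Seq n r) → Dec (HasShortZS xs)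
hasShortZS? {n} = any-sublist? λ ys → (1 ≤? length ys) ×-dec (length ys ≤? n) ×-dec zeroSum? ys

zeroSum-↭ : ∀ {n r} {xs ys : Seq n r} → xs ↭ ys → ZeroSum xs → ZeroSum ys
zeroSum-↭ {n} xs↭ys zs i = subst (n ∣_) (sum-↭ (↭.map⁺ (coord i) xs↭ys)) (zs i)

zeroSum-++⁻ʳ : ∀ {n r} (xs : Seq n r) {ys} → ZeroSum xs → ZeroSum (xs ++ ys) → ZeroSum ys
zeroSum-++⁻ʳ {n} xs zs₁ zs₁₂ i =
  ∣m+n∣m⇒∣n (subst (n ∣_) (sum-map-++ (coord i) xs _) (zs₁₂ i)) (zs₁ i)

zeroSum-replicateEach⁻ : ∀ {k r} (xs : Seq (suc k) r) → ZeroSum (replicateEach k xs) → ZeroSum xs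
zeroSum-replicateEach⁻ {k} xs zs i = ∣m+n∣m⇒∣n n∣kS+S n∣kS
  where
    S : ℕ
    S = sum (map (coord i) xs)
    n∣kS : suc k ∣ k * S
    n∣kS = subst (suc k ∣_) (sum-map-replicateEach (coord i) k xs) (zs i)
    n∣kS+S : suc k ∣ k * S + S
    n∣kS+S = subst (suc k ∣_) (+-comm S (k * S)) (m∣m*n S)

-- Each coordinate of −σ(xs) is computed as (n − 1)·σ mod n, avoiding truncated subtraction.
negSum : ∀ {k r} → Seq (suc k) r → Grp (suc k) r
negSum {k} xs = tabulate λ i → fromℕ< (m%n<n (k * sum (map (coord i) xs)) (suc k))

zeroSum-negSum∷ : ∀ {k r} (xs : Seq (suc k) r) → ZeroSum (negSum xs ∷ xs)
zeroSum-negSum∷ {k} xs i = ∣m+n∣m⇒∣n (subst (n ∣_) (sym rearranged) (m∣m*n S)) (n∣m*n (t / n))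
  where
    n S t : ℕ
    n = suc k
    S = sum (map (coord i) xs)
    t = k * S
    coord-negSum : coord i (negSum xs) ≡ t % n
    coord-negSum = ≡-trans (cong toℕ (Vec.lookup∘tabulate _ i)) (Fin.toℕ-fromℕ< _)
    rearranged : t / n * n + (coord i (negSum xs) + S) ≡ n * S
    rearranged = begin
      t / n * n + (coord i (negSum xs) + S) ≡⟨ cong (λ z → t / n * n + (z + S)) coord-negSum ⟩
      t / n * n + (t % n + S)               ≡⟨ +-assoc (t / n * n) _ _ ⟨
      t / n * n + t % n + S                 ≡⟨ cong (_+ S) (+-comm (t / n * n) _) ⟩
      t % n + t / n * n + S                 ≡⟨ cong (_+ S) (m≡m%n+[m/n]*n t n) ⟨
      t + S                                 ≡⟨ +-comm t S ⟩
      n * S                                 ∎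
      where open ≡-Reasoning

IsEta-unique : ∀ {n r η η′} → IsEta n r η → IsEta n r η′ → η ≡ η′
IsEta-unique (long⇒short , least) (long⇒short′ , least′) =
  ≤-antisym (least _ long⇒short′) (least′ _ long⇒short)

shortFree⇒length<η : ∀ {n r η} → IsEta n r η → ∀ {xs : Seq n r} → ShortFree xs → length xs < η
shortFree⇒length<η (long⇒short , _) {xs} free = ≰⇒> λ η≤ → free (long⇒short xs η≤)

module _ (m r : ℕ) where

  e₁ e₂ e₁₂ : Grp (suc (suc m)) (suc (suc r))
  e₁  = fsuc 0F ∷ 0F      ∷ Vec.replicate r 0F
  e₂  = 0F      ∷ fsuc 0F ∷ Vec.replicate r 0F
  e₁₂ = fsuc 0F ∷ fsuc 0F ∷ Vec.replicate r 0F

  threeBlocks : Seq (suc (suc m)) (suc (suc r))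
  threeBlocks = replicate (suc m) e₁ ++ replicate (suc m) e₂ ++ replicate (suc m) e₁₂

  threeBlocks-shortFree : ShortFree threeBlocks
  threeBlocks-shortFree (ys , ys⊆ , 0<∣ys∣ , ∣ys∣≤n , zs)
    with ⊆-++⁻ (replicate (suc m) e₁) ys⊆
  ... | as , ys′ , as⊆ , ys′⊆ , ≡-refl with ⊆-++⁻ (replicate (suc m) e₂) ys′⊆
  ... | bs , ts , bs⊆ , ts⊆ , ≡-refl =
    <⇒≱ (∣a+t∧∣b+t⇒n<a+b+t (<n as⊆) (<n bs⊆) (<n ts⊆)
          (subst (_ ∣_) (≡-trans (coordSum 0F) (simplify₁ a b t)) (zs 0F))
          (subst (_ ∣_) (≡-trans (coordSum (fsuc 0F)) (simplify₂ a b t)) (zs (fsuc 0F)))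
          (subst (0 <_) ∣ys∣ 0<∣ys∣))
        (subst (_≤ suc (suc m)) ∣ys∣ ∣ys∣≤n)
    where
      a b t : ℕ
      a = length as
      b = length bs
      t = length ts
      <n : ∀ {x zs} → zs ⊆ replicate (suc m) x → length zs < suc (suc m)
      <n zs⊆ = s≤s (≤-trans (length-mono-≤ zs⊆) (≤-reflexive (length-replicate (suc m))))
      simplify₁ : ∀ a b t → a * 1 + (b * 0 + t * 1) ≡ a + t
      simplify₁ = solve-∀
      simplify₂ : ∀ a b t → a * 0 + (b * 1 + t * 1) ≡ b + t
      simplify₂ = solve-∀
      ∣ys∣ : length (as ++ bs ++ ts) ≡ a + (b + t)
      ∣ys∣ = ≡-trans (length-++ as) (cong (a +_) (length-++ bs))
      coordSum : ∀ i → sum (map (coord i) (as ++ bs ++ ts))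
                       ≡ a * coord i e₁ + (b * coord i e₂ + t * coord i e₁₂)
      coordSum i = begin
        sum (map f (as ++ bs ++ ts))
          ≡⟨ ≡-trans (sum-map-++ f as _) (cong (sum (map f as) +_) (sum-map-++ f bs ts)) ⟩
        sum (map f as) + (sum (map f bs) + sum (map f ts))
          ≡⟨ cong₂ _+_ (Σ-block as⊆) (cong₂ _+_ (Σ-block bs⊆) (Σ-block ts⊆)) ⟩
        a * f e₁ + (b * f e₂ + t * f e₁₂)
          ∎
        where
          f : Grp (suc (suc m)) (suc (suc r)) → ℕ
          f = coord i
          Σ-block : ∀ {x zs} → zs ⊆ replicate (suc m) x → sum (map f zs) ≡ length zs * f x
          Σ-block = sum-map-⊆-replicate f (suc m)
          open ≡-Reasoning

  3[n∸1]<η : ∀ {η} → IsEta (suc (suc m)) (suc (suc r)) η → 3 * suc m < η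
  3[n∸1]<η {η} η-is = subst (_< η) ∣threeBlocks∣ (shortFree⇒length<η η-is threeBlocks-shortFree)
    where
      k : ℕ
      k = suc m
      ∣replicate++∣ : ∀ {x} ys → length (replicate k x ++ ys) ≡ k + length ys
      ∣replicate++∣ ys = ≡-trans (length-++ (replicate k _)) (cong (_+ length ys) (length-replicate k))
      ∣threeBlocks∣ : length threeBlocks ≡ 3 * k
      ∣threeBlocks∣ = begin
        length threeBlocks                   ≡⟨ ∣replicate++∣ _ ⟩
        k + length (replicate k e₂ ++ replicate k e₁₂)
                                             ≡⟨ cong (k +_) (∣replicate++∣ _) ⟩
        k + (k + length (replicate k e₁₂))   ≡⟨ cong (λ l → k + (k + l)) (length-replicate k) ⟩
        k + (k + k)                          ≡⟨ cong (λ l → k + (k + l)) (+-identityʳ k) ⟨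
        3 * k                                ∎
        where open ≡-Reasoning

shortFree⇒¬zeroSum : ∀ {m r c} → c ≤ suc (suc m) → IsEta (suc (suc m)) r (c * suc m + 1) →
                     PropertyC (suc (suc m)) r →
                     ∀ xs → length xs ≡ c * suc m → ShortFree xs → ¬ ZeroSum xs
shortFree⇒¬zeroSum {m} {c = c} c≤n η-is (c′ , 0<c′ , η′-is , shape) xs ∣xs∣ free zs
  with *-cancelʳ-≡ c′ c (suc m) (+-cancelʳ-≡ 1 _ _ (IsEta-unique η′-is η-is))
... | ≡-refl with shape xs ∣xs∣ free
... | gs , _ , xs↭ with ⊆-↭ (⊆-replicateEach m (toList gs)) (↭-sym xs↭)
... | ys , ys⊆xs , gs↭ys = free (ys , ys⊆xs , 0<∣ys∣ , ∣ys∣≤n , zeroSum-↭ gs↭ys zs-gs)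
  where
    ∣ys∣ : length ys ≡ c
    ∣ys∣ = ≡-trans (sym (↭.↭-length gs↭ys)) (Vec.length-toList gs)
    0<∣ys∣ : 0 < length ys
    0<∣ys∣ = subst (0 <_) (sym ∣ys∣) 0<c′
    ∣ys∣≤n : length ys ≤ suc (suc m)
    ∣ys∣≤n = subst (_≤ suc (suc m)) (sym ∣ys∣) c≤n
    zs-gs : ZeroSum (toList gs)
    zs-gs = zeroSum-replicateEach⁻ (toList gs) (zeroSum-↭ xs↭ zs)

zeroSum⇒hasShortZS : ∀ {m r c} → c ≤ suc (suc m) → IsEta (suc (suc m)) r (c * suc m + 1) →
                     PropertyC (suc (suc m)) r →
                     ∀ xs → length xs ≡ c * suc m → ZeroSum xs → HasShortZS xs
zeroSum⇒hasShortZS c≤n η-is propertyC xs ∣xs∣ zs =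
  decidable-stable (hasShortZS? xs) λ free → shortFree⇒¬zeroSum c≤n η-is propertyC xs ∣xs∣ free zs

hasShortZS-negSum∷⇒hasZS : ∀ {k r} (T : Seq (suc k) r) → suc k ≤ length T →
                           HasShortZS (negSum T ∷ T) → HasZS T
hasShortZS-negSum∷⇒hasZS T _ (ys , _ ∷ʳ ys⊆T , 0<∣ys∣ , _ , zs) = ys , ys⊆T , 0<∣ys∣ , zs
hasShortZS-negSum∷⇒hasZS {k} {r} T n≤∣T∣ (_ , _∷_ {xs = us} ≡-refl us⊆T , _ , s≤s ∣us∣≤k , zs) =
  rest , complement-⊆ us⊆T , 0<∣rest∣ , zeroSum-++⁻ʳ (negSum T ∷ us) zs zs-all
  where
    rest : Seq (suc k) r
    rest = complement us⊆T
    zs-all : ZeroSum ((negSum T ∷ us) ++ rest)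
    zs-all = zeroSum-↭ (↭-sym (prep (negSum T) (++-complement-↭ us⊆T))) (zeroSum-negSum∷ T)
    ∣us∣+∣rest∣ : length us + length rest ≡ length T
    ∣us∣+∣rest∣ = ≡-trans (sym (length-++ us)) (↭.↭-length (++-complement-↭ us⊆T))
    0<∣rest∣ : 0 < length rest
    0<∣rest∣ = n≢0⇒n>0 λ ∣rest∣≡0 → <⇒≱ (s≤s ∣us∣≤k) (≤-trans n≤∣T∣ (≤-reflexive (begin
      length T               ≡⟨ ∣us∣+∣rest∣ ⟨
      length us + length rest ≡⟨ cong (length us +_) ∣rest∣≡0 ⟩
      length us + 0           ≡⟨ +-identityʳ _ ⟩
      length us               ∎)))
      where open ≡-Reasoning

shortZeroSums⇒D<t : ∀ {k r D} t → IsDavenport (suc k) r D → suc k < t →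
                    (∀ (xs : Seq (suc k) r) → length xs ≡ t → ZeroSum xs → HasShortZS xs) → D < t
shortZeroSums⇒D<t {k} {r} (suc L) (_ , least) (s≤s n≤L) zeroSum⇒short = s≤s (least L long⇒hasZS)
  where
    long⇒hasZS : ∀ xs → L ≤ length xs → HasZS xs
    long⇒hasZS xs L≤∣xs∣ =
      let (ys , ys⊆T , 0<∣ys∣ , zs) = hasShortZS-negSum∷⇒hasZS T (subst (suc k ≤_) (sym ∣T∣) n≤L)
            (zeroSum⇒short (negSum T ∷ T) (cong suc ∣T∣) (zeroSum-negSum∷ T))
      in ys , ⊆-trans ys⊆T (take-⊆ L xs) , 0<∣ys∣ , zs
      where
        T : Seq (suc k) r
        T = take L xs
        ∣T∣ : length T ≡ L
        ∣T∣ = ≡-trans (length-take L xs) (m≤n⇒m⊓n≡m L≤∣xs∣)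

lemma2p1 : (n r c D η : ℕ) → 2 ≤ n → 2 ≤ r → 1 ≤ c →
           IsDavenport n r D → IsEta n r η → η ≡ c * (n ∸ 1) + 1 →
           c ≤ n → PropertyC n r → InC0 n r D η (η ∸ 1)
lemma2p1 (suc (suc m)) (suc (suc r)) c D .(c * suc m + 1) (s≤s (s≤s z≤n)) (s≤s (s≤s z≤n)) _
         D-is η-is ≡-refl c≤n propertyC =
  D+1≤η∸1 , ≤-refl , λ xs ∣xs∣ → zeroSum⇒short xs (≡-trans ∣xs∣ η∸1≡t)
  where
    t : ℕ
    t = c * suc m
    η∸1≡t : t + 1 ∸ 1 ≡ t
    η∸1≡t = m+n∸n≡m t 1
    zeroSum⇒short : ∀ xs → length xs ≡ t → ZeroSum xs → HasShortZS xs
    zeroSum⇒short = zeroSum⇒hasShortZS c≤n η-is propertyC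
    3≤c : 3 ≤ c
    3≤c = *-cancelʳ-≤ 3 c (suc m)
            (m<1+n⇒m≤n (subst (3 * suc m <_) (+-comm t 1) (3[n∸1]<η m r η-is)))
    n<t : suc (suc m) < t
    n<t = <-≤-trans (n<3[n∸1] m) (*-monoˡ-≤ (suc m) 3≤c)
    D+1≤η∸1 : D + 1 ≤ t + 1 ∸ 1
    D+1≤η∸1 = subst₂ _≤_ (+-comm 1 D) (sym η∸1≡t) (shortZeroSums⇒D<t t D-is n<t zeroSum⇒short)
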